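{- Let $\Theta:2^\omega\to 2^\omega$ be a homeomorphism of Cantor space, let $S(n)=n+1$ be the successor function on $\omega$, and let $S^{\star}:2^\omega\to 2^\omega$ be defined by $S^{\star}(A)(n)=A(S(n))=A(n+1)$. If the function $\Theta^{ -1}\circ S^{\star}\circ\Theta$ is computable, then $\Theta$ is computable.
   Context: A function $G:2^\omega\to 2^\omega$ is computable if there is a Turing functional $\Psi$ with $\Psi^A=G(A)$ (total) for every $A\in 2^\omega$. -}

module Defs where

open import Data.Nat using (ℕ; zero; suc; _<_)
open import Data.Bool using (Bool; true; false; if_then_else_)
open import Data.Fin using (Fin)
open import Data.Vec using (Vec; []; _∷_; lookup)
open import Data.Product using (Σ; ∃; _,_)
open import Relation.Binary.PropositionalEquality using (_≡_)

Cantor : Set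
Cantor = ℕ → Bool

_≈_ : Cantor → Cantor → Set
A ≈ B = ∀ n → A n ≡ B n

AgreeUpTo : ℕ → Cantor → Cantor → Set
AgreeUpTo m A B = ∀ i → i < m → A i ≡ B i

Continuous : (Cantor → Cantor) → Set
Continuous F = ∀ A n → ∃ λ m → ∀ B → AgreeUpTo m A B → F A n ≡ F B n

record IsHomeomorphism (Θ : Cantor → Cantor) : Set where
  field
    inverse      : Cantor → Cantor
    left-inv     : ∀ A → inverse (Θ A) ≈ A
    right-inv    : ∀ A → Θ (inverse A) ≈ A
    continuous   : Continuous Θ
    inverse-cont : Continuous inverse
open IsHomeomorphism public

S : ℕ → ℕ
S n = suc n

S⋆ : Cantor → Cantor
S⋆ A n = A (S n)

_∘C_ : (Cantor → Cantor) → (Cantor → Cantor) → (Cantor → Cantor)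
(F ∘C G) A = F (G A)

-- Codes of oracle (Kleene) partial recursive functions of arity k
data Code : ℕ → Set where
  zeroF  : ∀ {k} → Code k
  succF  : Code 1
  proj   : ∀ {k} → Fin k → Code k
  comp   : ∀ {k m} → Code m → Vec (Code k) m → Code k
  prec   : ∀ {k} → Code k → Code (suc (suc k)) → Code (suc k)
  mu     : ∀ {k} → Code (suc k) → Code k
  oracle : Code 1

bit : Bool → ℕ
bit b = if b then 1 else 0

data _⊢_[_]⇓_ (A : Cantor) : ∀ {k} → Code k → Vec ℕ k → ℕ → Set
data _⊢_[_]⇓*_ (A : Cantor) {k : ℕ} : ∀ {m} → Vec (Code k) m → Vec ℕ k → Vec ℕ m → Set

data _⊢_[_]⇓_ A where
  ev-zero   : ∀ {k} {xs : Vec ℕ k} → A ⊢ zeroF [ xs ]⇓ 0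
  ev-succ   : ∀ {x} → A ⊢ succF [ x ∷ [] ]⇓ suc x
  ev-proj   : ∀ {k} (i : Fin k) {xs : Vec ℕ k} → A ⊢ proj i [ xs ]⇓ lookup xs i
  ev-comp   : ∀ {k m} {f : Code m} {gs : Vec (Code k) m} {xs ys y} →
              A ⊢ gs [ xs ]⇓* ys → A ⊢ f [ ys ]⇓ y → A ⊢ comp f gs [ xs ]⇓ y
  ev-prec0  : ∀ {k} {f : Code k} {g : Code (suc (suc k))} {xs y} →
              A ⊢ f [ xs ]⇓ y → A ⊢ prec f g [ 0 ∷ xs ]⇓ y
  ev-precS  : ∀ {k} {f : Code k} {g : Code (suc (suc k))} {n xs r y} →
              A ⊢ prec f g [ n ∷ xs ]⇓ r → A ⊢ g [ n ∷ r ∷ xs ]⇓ y →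
              A ⊢ prec f g [ suc n ∷ xs ]⇓ y
  ev-mu     : ∀ {k} {f : Code (suc k)} {xs n} →
              A ⊢ f [ n ∷ xs ]⇓ 0 →
              (∀ i → i < n → ∃ λ v → A ⊢ f [ i ∷ xs ]⇓ suc v) →
              A ⊢ mu f [ xs ]⇓ n
  ev-oracle : ∀ {x} → A ⊢ oracle [ x ∷ [] ]⇓ bit (A x)

data _⊢_[_]⇓*_ A where
  []  : ∀ {xs} → A ⊢ [] [ xs ]⇓* []
  _∷_ : ∀ {m g} {gs : Vec _ m} {xs y ys} →
        A ⊢ g [ xs ]⇓ y → A ⊢ gs [ xs ]⇓* ys → A ⊢ (g ∷ gs) [ xs ]⇓* (y ∷ ys)

Computable : (Cantor → Cantor) → Set
Computable G = Σ (Code 1) λ Ψ → ∀ A n → A ⊢ Ψ [ n ∷ [] ]⇓ bit (G A n)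

-- Write F = Θ⁻¹ ∘ S⋆ ∘ Θ, computed by Φ.  Since Θ ∘ F = S⋆ ∘ Θ, the n-th bit of Θ A is the bit
-- Θ (Fⁿ A) 0.  By compactness of Cantor space (where excluded middle is used) that bit depends only on
-- the first m bits of its argument, for one fixed m, so it is computed by a finite decision tree.  It
-- remains to compute m bits of Fⁿ A from A, uniformly in n.  Simulating Φ on a finite initial segment
-- σ of A, and flagging every query beyond σ, certifies an initial segment of F A; iterating this n
-- times starting from a long enough initial segment of A (one exists by the use principle, and it
-- is found by unbounded search) leaves at least m bits of Fⁿ A.

module Submission where

open import Defs
open import Level using (0ℓ)
open import Axiom.ExcludedMiddle using (ExcludedMiddle)
open import Function using (_∘_; id; case_of_; Equivalence)
open import Data.Nat using (ℕ; zero; suc; _+_; _∸_; _<_; _≤_; z≤n; s≤s; _<ᵇ_; _⊔_)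
open import Data.Nat.Properties
open import Data.Nat.Tactic.RingSolver using (solve-∀)
open import Data.Bool using (Bool; true; false; not; _∨_; _∧_)
open import Data.Bool.Properties using (T-≡; ∨-conicalˡ; ∨-conicalʳ; ∧-conicalʳ; not-injective)
open import Data.Empty using (⊥-elim)
open import Data.Sum using (inj₁; inj₂)
open import Data.Fin using (Fin; zero; suc; _↑ʳ_)
open import Data.Vec using (Vec; []; _∷_; lookup)
open import Data.List using (List; []; _∷_; length; _++_)
open import Data.List.Properties using (length-++)
open import Data.Product using (∃; _,_; proj₁; proj₂; _×_)
open import Relation.Binary.PropositionalEquality
open import Relation.Binary.Definitions using (tri<; tri≈; tri>)
open import Relation.Nullary using (yes; no; Dec; ¬_)
open import Relation.Nullary.Reflects using (ofʸ; ofⁿ)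

⇓-cast : ∀ {A k} {c : Code k} {xs y y′} → y ≡ y′ → A ⊢ c [ xs ]⇓ y → A ⊢ c [ xs ]⇓ y′
⇓-cast refl d = d

comp₁⇓ : ∀ {A k} {f : Code 1} {g : Code k} {xs y z} →
  A ⊢ g [ xs ]⇓ y → A ⊢ f [ y ∷ [] ]⇓ z → A ⊢ comp f (g ∷ []) [ xs ]⇓ z
comp₁⇓ dg df = ev-comp (dg ∷ []) df

comp₂⇓ : ∀ {A k} {f : Code 2} {g h : Code k} {xs y y′ z} →
  A ⊢ g [ xs ]⇓ y → A ⊢ h [ xs ]⇓ y′ → A ⊢ f [ y ∷ y′ ∷ [] ]⇓ z → A ⊢ comp f (g ∷ h ∷ []) [ xs ]⇓ z
comp₂⇓ dg dh df = ev-comp (dg ∷ dh ∷ []) df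

#0 : ∀ {k} → Code (suc k)
#0 = proj zero

#1 : ∀ {k} → Code (suc (suc k))
#1 = proj (suc zero)

#2 : ∀ {k} → Code (suc (suc (suc k)))
#2 = proj (suc (suc zero))

constᶜ : ∀ {k} → ℕ → Code k
constᶜ zero = zeroF
constᶜ (suc n) = comp succF (constᶜ n ∷ [])

constᶜ⇓ : ∀ {A k} n {xs : Vec ℕ k} → A ⊢ constᶜ n [ xs ]⇓ n
constᶜ⇓ zero = ev-zero
constᶜ⇓ (suc n) = comp₁⇓ (constᶜ⇓ n) ev-succ

-- Primitive recursive arithmetic, each function defined by the recursion its code implements

isZero : ℕ → ℕ
isZero zero = 1
isZero (suc _) = 0

sg : ℕ → ℕ
sg zero = 0
sg (suc _) = 1

_∧ℕ_ : ℕ → ℕ → ℕ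
zero ∧ℕ b = 0
suc _ ∧ℕ b = b

parity : ℕ → ℕ
parity zero = 0
parity (suc n) = isZero (parity n)

half : ℕ → ℕ
half zero = 0
half (suc n) = half n + parity n

half^ : ℕ → ℕ → ℕ
half^ zero s = s
half^ (suc x) s = half (half^ x s)

pow2 : ℕ → ℕ
pow2 zero = 1
pow2 (suc n) = pow2 n + pow2 n

addᶜ : Code 2
addᶜ = prec #0 (comp succF (#1 ∷ []))

addᶜ⇓ : ∀ {A} a b → A ⊢ addᶜ [ a ∷ b ∷ [] ]⇓ (a + b)
addᶜ⇓ zero b = ev-prec0 (ev-proj zero)
addᶜ⇓ (suc a) b = ev-precS (addᶜ⇓ a b) (comp₁⇓ (ev-proj (suc zero)) ev-succ)

doubleᶜ : Code 1
doubleᶜ = comp addᶜ (#0 ∷ #0 ∷ [])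

doubleᶜ⇓ : ∀ {A} a → A ⊢ doubleᶜ [ a ∷ [] ]⇓ (a + a)
doubleᶜ⇓ a = comp₂⇓ (ev-proj zero) (ev-proj zero) (addᶜ⇓ a a)

isZeroᶜ : Code 1
isZeroᶜ = prec (constᶜ 1) zeroF

isZeroᶜ⇓ : ∀ {A} a → A ⊢ isZeroᶜ [ a ∷ [] ]⇓ isZero a
isZeroᶜ⇓ zero = ev-prec0 (constᶜ⇓ 1)
isZeroᶜ⇓ (suc a) = ev-precS (isZeroᶜ⇓ a) ev-zero

sgᶜ : Code 1
sgᶜ = prec zeroF (constᶜ 1)

sgᶜ⇓ : ∀ {A} a → A ⊢ sgᶜ [ a ∷ [] ]⇓ sg a
sgᶜ⇓ zero = ev-prec0 ev-zero
sgᶜ⇓ (suc a) = ev-precS (sgᶜ⇓ a) (constᶜ⇓ 1)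

∧ℕᶜ : Code 2
∧ℕᶜ = prec zeroF #2

∧ℕᶜ⇓ : ∀ {A} a b → A ⊢ ∧ℕᶜ [ a ∷ b ∷ [] ]⇓ (a ∧ℕ b)
∧ℕᶜ⇓ zero b = ev-prec0 ev-zero
∧ℕᶜ⇓ (suc a) b = ev-precS (∧ℕᶜ⇓ a b) (ev-proj (suc (suc zero)))

parityᶜ : Code 1
parityᶜ = prec zeroF (comp isZeroᶜ (#1 ∷ []))

parityᶜ⇓ : ∀ {A} a → A ⊢ parityᶜ [ a ∷ [] ]⇓ parity a
parityᶜ⇓ zero = ev-prec0 ev-zero
parityᶜ⇓ (suc a) = ev-precS (parityᶜ⇓ a) (comp₁⇓ (ev-proj (suc zero)) (isZeroᶜ⇓ (parity a)))

halfᶜ : Code 1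
halfᶜ = prec zeroF (comp addᶜ (#1 ∷ comp parityᶜ (#0 ∷ []) ∷ []))

halfᶜ⇓ : ∀ {A} a → A ⊢ halfᶜ [ a ∷ [] ]⇓ half a
halfᶜ⇓ zero = ev-prec0 ev-zero
halfᶜ⇓ (suc a) = ev-precS (halfᶜ⇓ a)
  (comp₂⇓ (ev-proj (suc zero)) (comp₁⇓ (ev-proj zero) (parityᶜ⇓ a)) (addᶜ⇓ (half a) (parity a)))

half^ᶜ : Code 2
half^ᶜ = prec #0 (comp halfᶜ (#1 ∷ []))

half^ᶜ⇓ : ∀ {A} x s → A ⊢ half^ᶜ [ x ∷ s ∷ [] ]⇓ half^ x s
half^ᶜ⇓ zero s = ev-prec0 (ev-proj zero)
half^ᶜ⇓ (suc x) s = ev-precS (half^ᶜ⇓ x s) (comp₁⇓ (ev-proj (suc zero)) (halfᶜ⇓ (half^ x s)))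

pow2ᶜ : Code 1
pow2ᶜ = prec (constᶜ 1) (comp doubleᶜ (#1 ∷ []))

pow2ᶜ⇓ : ∀ {A} n → A ⊢ pow2ᶜ [ n ∷ [] ]⇓ pow2 n
pow2ᶜ⇓ zero = ev-prec0 (constᶜ⇓ 1)
pow2ᶜ⇓ (suc n) = ev-precS (pow2ᶜ⇓ n) (comp₁⇓ (ev-proj (suc zero)) (doubleᶜ⇓ (pow2 n)))

infix 25 _∷₂_
_∷₂_ : Bool → ℕ → ℕ
b ∷₂ n = bit b + (n + n)

isZero-bit : ∀ b → isZero (bit b) ≡ bit (not b)
isZero-bit false = refl
isZero-bit true = refl

∧ℕ-bit : ∀ a b → bit a ∧ℕ bit b ≡ bit (a ∧ b)
∧ℕ-bit false b = refl
∧ℕ-bit true b = refl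

bit-injective : ∀ {a b} → bit a ≡ bit b → a ≡ b
bit-injective {false} {false} _ = refl
bit-injective {true} {true} _ = refl

isZero³ : ∀ x → isZero (isZero (isZero x)) ≡ isZero x
isZero³ zero = refl
isZero³ (suc x) = refl

parity-+2 : ∀ m → parity (2 + m) ≡ parity m
parity-+2 zero = refl
parity-+2 (suc m) = isZero³ (parity m)

parity+isZero : ∀ m → parity m + isZero (parity m) ≡ 1
parity+isZero zero = refl
parity+isZero (suc m) with parity m
... | zero = refl
... | suc _ = refl

half-+2 : ∀ m → half (2 + m) ≡ suc (half m)
half-+2 m = begin
  half m + parity m + isZero (parity m)   ≡⟨ +-assoc (half m) (parity m) _ ⟩
  half m + (parity m + isZero (parity m)) ≡⟨ cong (half m +_) (parity+isZero m) ⟩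
  half m + 1                              ≡⟨ +-comm (half m) 1 ⟩
  suc (half m)                            ∎
  where open ≡-Reasoning

parity-double : ∀ n → parity (n + n) ≡ 0
parity-double zero = refl
parity-double (suc n) rewrite +-suc n n = trans (parity-+2 (n + n)) (parity-double n)

half-double : ∀ n → half (n + n) ≡ n
half-double zero = refl
half-double (suc n) rewrite +-suc n n = trans (half-+2 (n + n)) (cong suc (half-double n))

parity-∷₂ : ∀ b n → parity (b ∷₂ n) ≡ bit b
parity-∷₂ false n = parity-double n
parity-∷₂ true n = cong isZero (parity-double n)

half-∷₂ : ∀ b n → half (b ∷₂ n) ≡ n
half-∷₂ false n = half-double n
half-∷₂ true n rewrite parity-double n | +-identityʳ (half (n + n)) = half-double n

-- Coding finite strings: the bits of σ, least significant first, then a 1 marking the end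

⌜_⌝ : List Bool → ℕ
⌜ [] ⌝ = 1
⌜ b ∷ σ ⌝ = b ∷₂ ⌜ σ ⌝

pad : List Bool → Cantor
pad [] x = false
pad (b ∷ σ) zero = b
pad (b ∷ σ) (suc x) = pad σ x

prefix : Cantor → ℕ → List Bool
prefix A zero = []
prefix A (suc L) = prefix A L ++ A L ∷ []

_⊑_ : List Bool → Cantor → Set
σ ⊑ A = AgreeUpTo (length σ) (pad σ) A

half^-suc : ∀ x s → half^ (suc x) s ≡ half^ x (half s)
half^-suc zero s = refl
half^-suc (suc x) s = cong half (half^-suc x s)

half^-zero : ∀ x → half^ x 0 ≡ 0
half^-zero zero = refl
half^-zero (suc x) rewrite half^-zero x = refl

half^-⌜∷⌝ : ∀ x b σ → half^ (suc x) ⌜ b ∷ σ ⌝ ≡ half^ x ⌜ σ ⌝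
half^-⌜∷⌝ x b σ rewrite half^-suc x ⌜ b ∷ σ ⌝ | half-∷₂ b ⌜ σ ⌝ = refl

sg-⌜⌝ : ∀ σ → sg ⌜ σ ⌝ ≡ 1
sg-⌜⌝ [] = refl
sg-⌜⌝ (true ∷ σ) = refl
sg-⌜⌝ (false ∷ σ) with ⌜ σ ⌝ | sg-⌜⌝ σ
... | suc _ | _ = refl

inRange-⌜⌝ : ∀ x σ → sg (half (half^ x ⌜ σ ⌝)) ≡ bit (x <ᵇ length σ)
inRange-⌜⌝ zero [] = refl
inRange-⌜⌝ (suc x) [] rewrite half^-suc x 1 | half^-zero x = refl
inRange-⌜⌝ zero (b ∷ σ) rewrite half-∷₂ b ⌜ σ ⌝ = sg-⌜⌝ σ
inRange-⌜⌝ (suc x) (b ∷ σ) rewrite half^-⌜∷⌝ x b σ = inRange-⌜⌝ x σ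

testBit-⌜⌝ : ∀ x σ → x < length σ → parity (half^ x ⌜ σ ⌝) ≡ bit (pad σ x)
testBit-⌜⌝ zero (b ∷ σ) _ = parity-∷₂ b ⌜ σ ⌝
testBit-⌜⌝ (suc x) (b ∷ σ) (s≤s x<∣σ∣) rewrite half^-⌜∷⌝ x b σ = testBit-⌜⌝ x σ x<∣σ∣

pad-≥ : ∀ x σ → length σ ≤ x → pad σ x ≡ false
pad-≥ x [] _ = refl
pad-≥ (suc x) (b ∷ σ) (s≤s ∣σ∣≤x) = pad-≥ x σ ∣σ∣≤x

pad-++ˡ : ∀ ρ τ x → x < length ρ → pad (ρ ++ τ) x ≡ pad ρ x
pad-++ˡ (b ∷ ρ) τ zero _ = refl
pad-++ˡ (b ∷ ρ) τ (suc x) (s≤s x<∣ρ∣) = pad-++ˡ ρ τ x x<∣ρ∣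

pad-snoc : ∀ ρ b → pad (ρ ++ b ∷ []) (length ρ) ≡ b
pad-snoc [] b = refl
pad-snoc (c ∷ ρ) b = pad-snoc ρ b

length-prefix : ∀ A L → length (prefix A L) ≡ L
length-prefix A zero = refl
length-prefix A (suc L) rewrite length-++ (prefix A L) {A L ∷ []} | length-prefix A L = +-comm L 1

pad-prefix : ∀ A L x → x < L → pad (prefix A L) x ≡ A x
pad-prefix A (suc L) x x<1+L with m<1+n⇒m<n∨m≡n x<1+L
... | inj₁ x<L = trans (pad-++ˡ (prefix A L) _ x (subst (x <_) (sym (length-prefix A L)) x<L))
                       (pad-prefix A L x x<L)
... | inj₂ refl = subst (λ y → pad (prefix A L ++ A L ∷ []) y ≡ A L) (length-prefix A L)
                        (pad-snoc (prefix A L) (A L))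

prefix-⊑ : ∀ A L → prefix A L ⊑ A
prefix-⊑ A L x x<∣σ∣ = pad-prefix A L x (subst (x <_) (length-prefix A L) x<∣σ∣)

⌜⌝-snoc : ∀ ρ b → ⌜ ρ ++ b ∷ [] ⌝ ≡ ⌜ ρ ⌝ + (pow2 (length ρ) + bit b ∧ℕ pow2 (length ρ))
⌜⌝-snoc [] false = refl
⌜⌝-snoc [] true = refl
⌜⌝-snoc (c ∷ ρ) false rewrite ⌜⌝-snoc ρ false = lemma (bit c) ⌜ ρ ⌝ (pow2 (length ρ))
  where
  lemma : ∀ a e p → a + ((e + (p + 0)) + (e + (p + 0))) ≡ (a + (e + e)) + ((p + p) + 0)
  lemma = solve-∀
⌜⌝-snoc (c ∷ ρ) true rewrite ⌜⌝-snoc ρ true = lemma (bit c) ⌜ ρ ⌝ (pow2 (length ρ))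
  where
  lemma : ∀ a e p → a + ((e + (p + p)) + (e + (p + p))) ≡ (a + (e + e)) + ((p + p) + (p + p))
  lemma = solve-∀

testBitᶜ : Code 2
testBitᶜ = comp parityᶜ (half^ᶜ ∷ [])

testBitᶜ⇓ : ∀ {A} x s → A ⊢ testBitᶜ [ x ∷ s ∷ [] ]⇓ parity (half^ x s)
testBitᶜ⇓ x s = comp₁⇓ (half^ᶜ⇓ x s) (parityᶜ⇓ _)

inRangeᶜ : Code 2
inRangeᶜ = comp sgᶜ (comp halfᶜ (half^ᶜ ∷ []) ∷ [])

inRangeᶜ⇓ : ∀ {A} x σ → A ⊢ inRangeᶜ [ x ∷ ⌜ σ ⌝ ∷ [] ]⇓ bit (x <ᵇ length σ)
inRangeᶜ⇓ x σ = ⇓-cast (inRange-⌜⌝ x σ) (comp₁⇓ (comp₁⇓ (half^ᶜ⇓ x ⌜ σ ⌝) (halfᶜ⇓ _)) (sgᶜ⇓ _))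

prefixᶜ : Code 2 → Code 2
prefixᶜ f = prec (constᶜ 1)
  (comp addᶜ (#1 ∷ comp addᶜ (pow2ᶜ′ ∷ comp ∧ℕᶜ (comp f (#0 ∷ #2 ∷ []) ∷ pow2ᶜ′ ∷ []) ∷ []) ∷ []))
  where
  pow2ᶜ′ : Code 3
  pow2ᶜ′ = comp pow2ᶜ (#0 ∷ [])

prefixᶜ⇓ : ∀ {B} f A p → (∀ x → B ⊢ f [ x ∷ p ∷ [] ]⇓ bit (A x)) →
  ∀ L → B ⊢ prefixᶜ f [ L ∷ p ∷ [] ]⇓ ⌜ prefix A L ⌝
prefixᶜ⇓ f A p f⇓ zero = ev-prec0 (constᶜ⇓ 1)
prefixᶜ⇓ {B} f A p f⇓ (suc L) = ev-precS (prefixᶜ⇓ f A p f⇓ L)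
  (⇓-cast snoc (comp₂⇓ (ev-proj (suc zero))
    (comp₂⇓ pow2⇓ (comp₂⇓ (comp₂⇓ (ev-proj zero) (ev-proj (suc (suc zero))) (f⇓ L)) pow2⇓ (∧ℕᶜ⇓ _ _)) (addᶜ⇓ _ _))
    (addᶜ⇓ _ _)))
  where
  pow2⇓ : B ⊢ comp pow2ᶜ (#0 ∷ []) [ L ∷ ⌜ prefix A L ⌝ ∷ p ∷ [] ]⇓ pow2 L
  pow2⇓ = comp₁⇓ (ev-proj zero) (pow2ᶜ⇓ L)
  snoc : ⌜ prefix A L ⌝ + (pow2 L + bit (A L) ∧ℕ pow2 L) ≡ ⌜ prefix A (suc L) ⌝
  snoc = sym (trans (⌜⌝-snoc (prefix A L) (A L))
                    (cong (λ n → ⌜ prefix A L ⌝ + (pow2 n + bit (A L) ∧ℕ pow2 n)) (length-prefix A L)))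

-- The use principle

data _⊢⟨_⟩_[_]⇓_ (A : Cantor) (N : ℕ) : ∀ {k} → Code k → Vec ℕ k → ℕ → Set
data _⊢⟨_⟩_[_]⇓*_ (A : Cantor) (N : ℕ) {k : ℕ} : ∀ {m} → Vec (Code k) m → Vec ℕ k → Vec ℕ m → Set

data _⊢⟨_⟩_[_]⇓_ A N where
  bd-zero   : ∀ {k} {xs : Vec ℕ k} → A ⊢⟨ N ⟩ zeroF [ xs ]⇓ 0
  bd-succ   : ∀ {x} → A ⊢⟨ N ⟩ succF [ x ∷ [] ]⇓ suc x
  bd-proj   : ∀ {k} (i : Fin k) {xs : Vec ℕ k} → A ⊢⟨ N ⟩ proj i [ xs ]⇓ lookup xs i
  bd-comp   : ∀ {k m} {f : Code m} {gs : Vec (Code k) m} {xs ys y} →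
              A ⊢⟨ N ⟩ gs [ xs ]⇓* ys → A ⊢⟨ N ⟩ f [ ys ]⇓ y → A ⊢⟨ N ⟩ comp f gs [ xs ]⇓ y
  bd-prec0  : ∀ {k} {f : Code k} {g : Code (suc (suc k))} {xs y} →
              A ⊢⟨ N ⟩ f [ xs ]⇓ y → A ⊢⟨ N ⟩ prec f g [ 0 ∷ xs ]⇓ y
  bd-precS  : ∀ {k} {f : Code k} {g : Code (suc (suc k))} {n xs r y} →
              A ⊢⟨ N ⟩ prec f g [ n ∷ xs ]⇓ r → A ⊢⟨ N ⟩ g [ n ∷ r ∷ xs ]⇓ y →
              A ⊢⟨ N ⟩ prec f g [ suc n ∷ xs ]⇓ y
  bd-mu     : ∀ {k} {f : Code (suc k)} {xs n} →
              A ⊢⟨ N ⟩ f [ n ∷ xs ]⇓ 0 →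
              (∀ i → i < n → ∃ λ v → A ⊢⟨ N ⟩ f [ i ∷ xs ]⇓ suc v) →
              A ⊢⟨ N ⟩ mu f [ xs ]⇓ n
  bd-oracle : ∀ {x} → x < N → A ⊢⟨ N ⟩ oracle [ x ∷ [] ]⇓ bit (A x)

data _⊢⟨_⟩_[_]⇓*_ A N where
  []  : ∀ {xs} → A ⊢⟨ N ⟩ [] [ xs ]⇓* []
  _∷_ : ∀ {m g} {gs : Vec _ m} {xs y ys} →
        A ⊢⟨ N ⟩ g [ xs ]⇓ y → A ⊢⟨ N ⟩ gs [ xs ]⇓* ys → A ⊢⟨ N ⟩ (g ∷ gs) [ xs ]⇓* (y ∷ ys)

bounded⇒⇓ : ∀ {A N k} {c : Code k} {xs y} → A ⊢⟨ N ⟩ c [ xs ]⇓ y → A ⊢ c [ xs ]⇓ y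
bounded⇒⇓* : ∀ {A N k m} {gs : Vec (Code k) m} {xs ys} → A ⊢⟨ N ⟩ gs [ xs ]⇓* ys → A ⊢ gs [ xs ]⇓* ys
bounded⇒⇓ bd-zero = ev-zero
bounded⇒⇓ bd-succ = ev-succ
bounded⇒⇓ (bd-proj i) = ev-proj i
bounded⇒⇓ (bd-comp ds d) = ev-comp (bounded⇒⇓* ds) (bounded⇒⇓ d)
bounded⇒⇓ (bd-prec0 d) = ev-prec0 (bounded⇒⇓ d)
bounded⇒⇓ (bd-precS d e) = ev-precS (bounded⇒⇓ d) (bounded⇒⇓ e)
bounded⇒⇓ (bd-mu d p) = ev-mu (bounded⇒⇓ d) (λ i i<n → proj₁ (p i i<n) , bounded⇒⇓ (proj₂ (p i i<n)))
bounded⇒⇓ (bd-oracle _) = ev-oracle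
bounded⇒⇓* [] = []
bounded⇒⇓* (d ∷ ds) = bounded⇒⇓ d ∷ bounded⇒⇓* ds

bounded-mono : ∀ {A N M k} {c : Code k} {xs y} → N ≤ M → A ⊢⟨ N ⟩ c [ xs ]⇓ y → A ⊢⟨ M ⟩ c [ xs ]⇓ y
bounded-mono* : ∀ {A N M k m} {gs : Vec (Code k) m} {xs ys} → N ≤ M → A ⊢⟨ N ⟩ gs [ xs ]⇓* ys → A ⊢⟨ M ⟩ gs [ xs ]⇓* ys
bounded-mono N≤M bd-zero = bd-zero
bounded-mono N≤M bd-succ = bd-succ
bounded-mono N≤M (bd-proj i) = bd-proj i
bounded-mono N≤M (bd-comp ds d) = bd-comp (bounded-mono* N≤M ds) (bounded-mono N≤M d)
bounded-mono N≤M (bd-prec0 d) = bd-prec0 (bounded-mono N≤M d)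
bounded-mono N≤M (bd-precS d e) = bd-precS (bounded-mono N≤M d) (bounded-mono N≤M e)
bounded-mono N≤M (bd-mu d p) = bd-mu (bounded-mono N≤M d) (λ i i<n → proj₁ (p i i<n) , bounded-mono N≤M (proj₂ (p i i<n)))
bounded-mono N≤M (bd-oracle x<N) = bd-oracle (<-≤-trans x<N N≤M)
bounded-mono* N≤M [] = []
bounded-mono* N≤M (d ∷ ds) = bounded-mono N≤M d ∷ bounded-mono* N≤M ds

bounded-transfer : ∀ {A B N k} {c : Code k} {xs y} → AgreeUpTo N A B → A ⊢⟨ N ⟩ c [ xs ]⇓ y → B ⊢⟨ N ⟩ c [ xs ]⇓ y
bounded-transfer* : ∀ {A B N k m} {gs : Vec (Code k) m} {xs ys} →
  AgreeUpTo N A B → A ⊢⟨ N ⟩ gs [ xs ]⇓* ys → B ⊢⟨ N ⟩ gs [ xs ]⇓* ys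
bounded-transfer A≈B bd-zero = bd-zero
bounded-transfer A≈B bd-succ = bd-succ
bounded-transfer A≈B (bd-proj i) = bd-proj i
bounded-transfer A≈B (bd-comp ds d) = bd-comp (bounded-transfer* A≈B ds) (bounded-transfer A≈B d)
bounded-transfer A≈B (bd-prec0 d) = bd-prec0 (bounded-transfer A≈B d)
bounded-transfer A≈B (bd-precS d e) = bd-precS (bounded-transfer A≈B d) (bounded-transfer A≈B e)
bounded-transfer A≈B (bd-mu d p) = bd-mu (bounded-transfer A≈B d) (λ i i<n → proj₁ (p i i<n) , bounded-transfer A≈B (proj₂ (p i i<n)))
bounded-transfer A≈B (bd-oracle {x} x<N) rewrite A≈B x x<N = bd-oracle x<N
bounded-transfer* A≈B [] = []
bounded-transfer* A≈B (d ∷ ds) = bounded-transfer A≈B d ∷ bounded-transfer* A≈B ds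

common-bound : (P : ℕ → ℕ → Set) → (∀ {N M i} → N ≤ M → P N i → P M i) →
  ∀ n → (∀ i → i < n → ∃ λ N → P N i) → ∃ λ N → ∀ i → i < n → P N i
common-bound P mono zero p = 0 , λ i ()
common-bound P mono (suc n) p with common-bound P mono n (λ i i<n → p i (m<n⇒m<1+n i<n)) | p n ≤-refl
... | N , below-n | M , at-n = N ⊔ M , below-1+n
  where
  below-1+n : ∀ i → i < suc n → P (N ⊔ M) i
  below-1+n i i<1+n with m<1+n⇒m<n∨m≡n i<1+n
  ... | inj₁ i<n = mono (m≤m⊔n N M) (below-n i i<n)
  ... | inj₂ refl = mono (m≤n⊔m N M) at-n

⇓⇒bounded : ∀ {A k} {c : Code k} {xs y} → A ⊢ c [ xs ]⇓ y → ∃ λ N → A ⊢⟨ N ⟩ c [ xs ]⇓ y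
⇓⇒bounded* : ∀ {A k m} {gs : Vec (Code k) m} {xs ys} → A ⊢ gs [ xs ]⇓* ys → ∃ λ N → A ⊢⟨ N ⟩ gs [ xs ]⇓* ys
⇓⇒bounded ev-zero = 0 , bd-zero
⇓⇒bounded ev-succ = 0 , bd-succ
⇓⇒bounded (ev-proj i) = 0 , bd-proj i
⇓⇒bounded (ev-comp ds d) with ⇓⇒bounded* ds | ⇓⇒bounded d
... | N , ds′ | M , d′ = N ⊔ M , bd-comp (bounded-mono* (m≤m⊔n N M) ds′) (bounded-mono (m≤n⊔m N M) d′)
⇓⇒bounded (ev-prec0 d) with ⇓⇒bounded d
... | N , d′ = N , bd-prec0 d′
⇓⇒bounded (ev-precS d e) with ⇓⇒bounded d | ⇓⇒bounded e
... | N , d′ | M , e′ = N ⊔ M , bd-precS (bounded-mono (m≤m⊔n N M) d′) (bounded-mono (m≤n⊔m N M) e′)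
⇓⇒bounded {A} (ev-mu {f = f} {xs} {n} d p) with ⇓⇒bounded d | common-bound Below bounded-mono-suc n below
  where
  Below : ℕ → ℕ → Set
  Below N i = ∃ λ v → A ⊢⟨ N ⟩ f [ i ∷ xs ]⇓ suc v
  bounded-mono-suc : ∀ {N M i} → N ≤ M → Below N i → Below M i
  bounded-mono-suc N≤M (v , d) = v , bounded-mono N≤M d
  below : ∀ i → i < n → ∃ λ N → Below N i
  below i i<n with ⇓⇒bounded (proj₂ (p i i<n))
  ... | N , d = N , proj₁ (p i i<n) , d
... | N , d′ | M , p′ = N ⊔ M , bd-mu (bounded-mono (m≤m⊔n N M) d′)
                                    (λ i i<n → proj₁ (p′ i i<n) , bounded-mono (m≤n⊔m N M) (proj₂ (p′ i i<n)))
⇓⇒bounded (ev-oracle {x}) = suc x , bd-oracle ≤-refl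
⇓⇒bounded* [] = 0 , []
⇓⇒bounded* (d ∷ ds) with ⇓⇒bounded d | ⇓⇒bounded* ds
... | N , d′ | M , ds′ = N ⊔ M , (bounded-mono (m≤m⊔n N M) d′ ∷ bounded-mono* (m≤n⊔m N M) ds′)

⇓-deterministic : ∀ {A k} {c : Code k} {xs y y′} → A ⊢ c [ xs ]⇓ y → A ⊢ c [ xs ]⇓ y′ → y ≡ y′
⇓-deterministic* : ∀ {A k m} {gs : Vec (Code k) m} {xs ys ys′} → A ⊢ gs [ xs ]⇓* ys → A ⊢ gs [ xs ]⇓* ys′ → ys ≡ ys′
⇓-deterministic ev-zero ev-zero = refl
⇓-deterministic ev-succ ev-succ = refl
⇓-deterministic (ev-proj i) (ev-proj .i) = refl
⇓-deterministic (ev-comp ds d) (ev-comp ds′ d′) with ⇓-deterministic* ds ds′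
... | refl = ⇓-deterministic d d′
⇓-deterministic (ev-prec0 d) (ev-prec0 d′) = ⇓-deterministic d d′
⇓-deterministic (ev-precS d e) (ev-precS d′ e′) with ⇓-deterministic d d′
... | refl = ⇓-deterministic e e′
⇓-deterministic (ev-mu {n = n} d p) (ev-mu {n = n′} d′ p′) with <-cmp n n′
... | tri≈ _ n≡n′ _ = n≡n′
... | tri< n<n′ _ _ with ⇓-deterministic d (proj₂ (p′ n n<n′))
...   | ()
⇓-deterministic (ev-mu {n = n} d p) (ev-mu {n = n′} d′ p′) | tri> _ _ n′<n with ⇓-deterministic d′ (proj₂ (p n′ n′<n))
...   | ()
⇓-deterministic ev-oracle ev-oracle = refl
⇓-deterministic* [] [] = refl
⇓-deterministic* (d ∷ ds) (d′ ∷ ds′) = cong₂ _∷_ (⇓-deterministic d d′) (⇓-deterministic* ds ds′)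

-- Simulation on finite strings

projs : ∀ {k m} → (Fin k → Fin m) → Vec (Code m) k
projs {zero} ρ = []
projs {suc k} ρ = proj (ρ zero) ∷ projs (ρ ∘ suc)

projs⇓ : ∀ {A k m} (ρ : Fin k → Fin m) (zs : Vec ℕ m) (ws : Vec ℕ k) →
  (∀ i → lookup zs (ρ i) ≡ lookup ws i) → A ⊢ projs ρ [ zs ]⇓* ws
projs⇓ ρ zs [] _ = []
projs⇓ ρ zs (w ∷ ws) eq = ⇓-cast (eq zero) (ev-proj (ρ zero)) ∷ projs⇓ (ρ ∘ suc) zs ws (eq ∘ suc)

drop₁ : ∀ {A k} {xs : Vec ℕ k} x → A ⊢ projs (1 ↑ʳ_) [ x ∷ xs ]⇓* xs
drop₁ {xs = xs} x = projs⇓ suc (x ∷ xs) xs (λ _ → refl)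

drop₂ : ∀ {A k} {xs : Vec ℕ k} x y → A ⊢ projs (2 ↑ʳ_) [ x ∷ y ∷ xs ]⇓* xs
drop₂ {xs = xs} x y = projs⇓ (2 ↑ʳ_) (x ∷ y ∷ xs) xs (λ _ → refl)

drop₃ : ∀ {A k} {xs : Vec ℕ k} x y z → A ⊢ projs (3 ↑ʳ_) [ x ∷ y ∷ z ∷ xs ]⇓* xs
drop₃ {xs = xs} x y z = projs⇓ (3 ↑ʳ_) (x ∷ y ∷ z ∷ xs) xs (λ _ → refl)

sg-bit+bit : ∀ a b → sg (bit a + bit b) ≡ bit (a ∨ b)
sg-bit+bit false false = refl
sg-bit+bit false true = refl
sg-bit+bit true b = refl

orᶜ : Code 2
orᶜ = comp sgᶜ (addᶜ ∷ [])

orᶜ⇓ : ∀ {A} a b → A ⊢ orᶜ [ bit a ∷ bit b ∷ [] ]⇓ bit (a ∨ b)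
orᶜ⇓ a b = ⇓-cast (sg-bit+bit a b) (comp₁⇓ (addᶜ⇓ (bit a) (bit b)) (sgᶜ⇓ _))

infix 25 _∷₂*_
_∷₂*_ : ∀ {m} → Vec Bool m → Vec ℕ m → Vec ℕ m
[] ∷₂* [] = []
(b ∷ bs) ∷₂* (y ∷ ys) = b ∷₂ y ∷ bs ∷₂* ys

or* : ∀ {m} → Vec Bool m → Bool
or* [] = false
or* (b ∷ bs) = b ∨ or* bs

anyFlagᶜ : ∀ {m} → Code m
anyFlagᶜ {zero} = zeroF
anyFlagᶜ {suc m} = comp orᶜ (comp parityᶜ (#0 ∷ []) ∷ comp anyFlagᶜ (projs (1 ↑ʳ_)) ∷ [])

anyFlagᶜ⇓ : ∀ {A m} (bs : Vec Bool m) ys → A ⊢ anyFlagᶜ [ bs ∷₂* ys ]⇓ bit (or* bs)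
anyFlagᶜ⇓ [] [] = ev-zero
anyFlagᶜ⇓ (b ∷ bs) (y ∷ ys) =
  comp₂⇓ (comp₁⇓ (ev-proj zero) (⇓-cast (parity-∷₂ b y) (parityᶜ⇓ _)))
         (ev-comp (drop₁ _) (anyFlagᶜ⇓ bs ys))
         (orᶜ⇓ b (or* bs))

mergeFlagsᶜ : ∀ {m} → Code (suc m)
mergeFlagsᶜ = comp addᶜ (anyFlagᶜ ∷ comp doubleᶜ (comp halfᶜ (#0 ∷ []) ∷ []) ∷ [])

mergeFlagsᶜ⇓ : ∀ {A m} a v (bs : Vec Bool m) ys → A ⊢ mergeFlagsᶜ [ a ∷₂ v ∷ bs ∷₂* ys ]⇓ (a ∨ or* bs) ∷₂ v
mergeFlagsᶜ⇓ a v bs ys =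
  comp₂⇓ (anyFlagᶜ⇓ (a ∷ bs) (v ∷ ys))
         (comp₁⇓ (comp₁⇓ (ev-proj zero) (⇓-cast (half-∷₂ a v) (halfᶜ⇓ _))) (doubleᶜ⇓ v))
         (addᶜ⇓ _ _)

tagᶜ : Code 2
tagᶜ = comp addᶜ (#1 ∷ comp doubleᶜ (#0 ∷ []) ∷ [])

tagᶜ⇓ : ∀ {A} n a → A ⊢ tagᶜ [ n ∷ bit a ∷ [] ]⇓ a ∷₂ n
tagᶜ⇓ n a = comp₂⇓ (ev-proj (suc zero)) (comp₁⇓ (ev-proj zero) (doubleᶜ⇓ n)) (addᶜ⇓ _ _)

-- sim c takes ⌜ σ ⌝ as an extra first argument and simulates c on the oracle pad σ.  Its result is
-- flagged when c queries the oracle at or beyond length σ, where pad σ need not agree with the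
-- oracle being approximated.
sim : ∀ {k} → Code k → Code (suc k)
sim* : ∀ {k m} → Vec (Code k) m → Vec (Code (suc k)) m
simValue* : ∀ {k m} → Vec (Code k) m → Vec (Code (suc k)) m
simPrec : ∀ {k} → Code k → Code (suc (suc k)) → Code (suc (suc k))
simSearch : ∀ {k} → Code (suc k) → Code (suc k)
flagsUpTo : ∀ {k} → Code (suc k) → Code (suc (suc k))
sim zeroF = zeroF
sim succF = comp succF (comp succF (comp doubleᶜ (#1 ∷ []) ∷ []) ∷ [])
sim (proj i) = comp doubleᶜ (proj (suc i) ∷ [])
sim (comp f gs) = comp mergeFlagsᶜ (comp (sim f) (#0 ∷ simValue* gs) ∷ sim* gs)
sim (prec f g) = comp (simPrec f g) (#1 ∷ #0 ∷ projs (2 ↑ʳ_))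
sim (mu f) = comp tagᶜ (simSearch f ∷ comp (flagsUpTo f) (simSearch f ∷ projs id) ∷ [])
sim oracle = comp addᶜ (comp isZeroᶜ (inRange ∷ [])
                       ∷ comp doubleᶜ (comp ∧ℕᶜ (inRange ∷ comp testBitᶜ (#1 ∷ #0 ∷ []) ∷ []) ∷ []) ∷ [])
  where
  inRange : Code 2
  inRange = comp inRangeᶜ (#1 ∷ #0 ∷ [])
sim* [] = []
sim* (g ∷ gs) = sim g ∷ sim* gs
simValue* [] = []
simValue* (g ∷ gs) = comp halfᶜ (sim g ∷ []) ∷ simValue* gs
simPrec f g = prec (sim f) (comp mergeFlagsᶜ (comp (sim g) (#2 ∷ #0 ∷ comp halfᶜ (#1 ∷ []) ∷ projs (3 ↑ʳ_)) ∷ #1 ∷ []))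
simSearch f = mu (comp halfᶜ (comp (sim f) (#1 ∷ #0 ∷ projs (2 ↑ʳ_)) ∷ []))
flagsUpTo f = prec (comp parityᶜ (comp (sim f) (#0 ∷ zeroF ∷ projs (1 ↑ʳ_)) ∷ []))
                   (comp orᶜ (#1 ∷ comp parityᶜ (comp (sim f) (#2 ∷ comp succF (#0 ∷ []) ∷ projs (3 ↑ʳ_)) ∷ []) ∷ []))

simValue*⇓ : ∀ {B k m} (gs : Vec (Code k) m) bs ys zs → B ⊢ sim* gs [ zs ]⇓* bs ∷₂* ys → B ⊢ simValue* gs [ zs ]⇓* ys
simValue*⇓ [] [] [] zs [] = []
simValue*⇓ (g ∷ gs) (b ∷ bs) (y ∷ ys) zs (d ∷ ds) =
  comp₁⇓ d (⇓-cast (half-∷₂ b y) (halfᶜ⇓ _)) ∷ simValue*⇓ gs bs ys zs ds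

any≤ : (ℕ → Bool) → ℕ → Bool
any≤ fl zero = fl 0
any≤ fl (suc j) = any≤ fl j ∨ fl (suc j)

any≤-false : ∀ fl j → any≤ fl j ≡ false → ∀ i → i ≤ j → fl i ≡ false
any≤-false fl zero eq .zero z≤n = eq
any≤-false fl (suc j) eq i i≤1+j with m≤n⇒m<n∨m≡n i≤1+j
... | inj₁ (s≤s i≤j) = any≤-false fl j (∨-conicalˡ _ _ eq) i i≤j
... | inj₂ refl = ∨-conicalʳ (any≤ fl j) _ eq

all-false⇒any≤-false : ∀ fl j → (∀ i → i ≤ j → fl i ≡ false) → any≤ fl j ≡ false
all-false⇒any≤-false fl zero all = all 0 z≤n
all-false⇒any≤-false fl (suc j) all
  rewrite all-false⇒any≤-false fl j (λ i i≤j → all i (m≤n⇒m≤1+n i≤j)) = all (suc j) ≤-refl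

flagsUpTo⇓ : ∀ {B k} (f : Code (suc k)) s xs (fl : ℕ → Bool) n →
  (∀ j → j ≤ n → ∃ λ v → B ⊢ sim f [ s ∷ j ∷ xs ]⇓ fl j ∷₂ v) →
  ∀ j → j ≤ n → B ⊢ flagsUpTo f [ j ∷ s ∷ xs ]⇓ bit (any≤ fl j)
flagsUpTo⇓ f s xs fl n runs zero 0≤n =
  ev-prec0 (comp₁⇓ (ev-comp (ev-proj zero ∷ ev-zero ∷ drop₁ s) (proj₂ (runs 0 0≤n)))
                   (⇓-cast (parity-∷₂ (fl 0) (proj₁ (runs 0 0≤n))) (parityᶜ⇓ _)))
flagsUpTo⇓ f s xs fl n runs (suc j) 1+j≤n =
  ev-precS (flagsUpTo⇓ f s xs fl n runs j (≤-trans (n≤1+n j) 1+j≤n))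
    (comp₂⇓ (ev-proj (suc zero))
            (comp₁⇓ (ev-comp (ev-proj (suc (suc zero)) ∷ comp₁⇓ (ev-proj zero) ev-succ ∷ drop₃ j _ s)
                             (proj₂ (runs (suc j) 1+j≤n)))
                    (⇓-cast (parity-∷₂ (fl (suc j)) (proj₁ (runs (suc j) 1+j≤n))) (parityᶜ⇓ _)))
            (orᶜ⇓ (any≤ fl j) (fl (suc j))))

module Simulation (σ : List Bool) where

  -- N bounds the oracle queries of the simulated computation on pad σ
  record Flagged (N : ℕ) (Run : Bool → Set) (Bounded : Set) : Set where
    field
      flag      : Bool
      run       : Run flag
      bounded   : flag ≡ false → Bounded
      unflagged : N ≤ length σ → flag ≡ false

  Sim : ∀ {k} → ℕ → Code k → Vec ℕ k → ℕ → Set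
  Sim N c xs v = Flagged N (λ b → ∀ B → B ⊢ sim c [ ⌜ σ ⌝ ∷ xs ]⇓ b ∷₂ v) (pad σ ⊢⟨ length σ ⟩ c [ xs ]⇓ v)

  SimPrec : ∀ {k} → ℕ → Code k → Code (suc (suc k)) → ℕ → Vec ℕ k → ℕ → Set
  SimPrec N f g n xs v =
    Flagged N (λ b → ∀ B → B ⊢ simPrec f g [ n ∷ ⌜ σ ⌝ ∷ xs ]⇓ b ∷₂ v)
              (pad σ ⊢⟨ length σ ⟩ prec f g [ n ∷ xs ]⇓ v)

  record Sim* {k m} (N : ℕ) (gs : Vec (Code k) m) (xs : Vec ℕ k) (ys : Vec ℕ m) : Set where
    field
      flags     : Vec Bool m
      run       : ∀ B → B ⊢ sim* gs [ ⌜ σ ⌝ ∷ xs ]⇓* flags ∷₂* ys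
      bounded   : or* flags ≡ false → pad σ ⊢⟨ length σ ⟩ gs [ xs ]⇓* ys
      unflagged : N ≤ length σ → or* flags ≡ false

  module _ {N : ℕ} where

    sim-[] : ∀ {k} {xs : Vec ℕ k} → Sim* N [] xs []
    sim-[] = record { flags = [] ; run = λ _ → [] ; bounded = λ _ → [] ; unflagged = λ _ → refl }

    sim-∷ : ∀ {k m} {g} {gs : Vec (Code k) m} {xs y ys} → Sim N g xs y → Sim* N gs xs ys → Sim* N (g ∷ gs) xs (y ∷ ys)
    sim-∷ r rs = record
      { flags     = flag r ∷ flags rs
      ; run       = λ B → run r B ∷ Sim*.run rs B
      ; bounded   = λ eq → bounded r (∨-conicalˡ _ _ eq) ∷ Sim*.bounded rs (∨-conicalʳ _ _ eq)
      ; unflagged = λ N≤∣σ∣ → cong₂ _∨_ (unflagged r N≤∣σ∣) (Sim*.unflagged rs N≤∣σ∣)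
      }
      where
      open Flagged
      open Sim* using (flags)

    sim-comp : ∀ {k m} {f : Code m} {gs : Vec (Code k) m} {xs ys y} →
      Sim* N gs xs ys → Sim N f ys y → Sim N (comp f gs) xs y
    sim-comp {gs = gs} {xs} {ys} {y} rs r = record
      { flag      = flag r ∨ or* (flags rs)
      ; run       = λ B → ev-comp (ev-comp (ev-proj zero ∷ simValue*⇓ gs (flags rs) ys (⌜ σ ⌝ ∷ xs) (Sim*.run rs B)) (run r B)
                                   ∷ Sim*.run rs B)
                                  (mergeFlagsᶜ⇓ (flag r) y (flags rs) ys)
      ; bounded   = λ eq → bd-comp (Sim*.bounded rs (∨-conicalʳ _ _ eq)) (bounded r (∨-conicalˡ _ _ eq))
      ; unflagged = λ N≤∣σ∣ → cong₂ _∨_ (unflagged r N≤∣σ∣) (Sim*.unflagged rs N≤∣σ∣)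
      }
      where
      open Flagged
      open Sim* using (flags)

    sim-prec0 : ∀ {k} {f : Code k} {g : Code (suc (suc k))} {xs y} → Sim N f xs y → SimPrec N f g 0 xs y
    sim-prec0 r = record
      { flag = flag r ; run = λ B → ev-prec0 (run r B) ; bounded = bd-prec0 ∘ bounded r ; unflagged = unflagged r }
      where open Flagged

    sim-precS : ∀ {k} {f : Code k} {g : Code (suc (suc k))} {n xs r y} →
      SimPrec N f g n xs r → Sim N g (n ∷ r ∷ xs) y → SimPrec N f g (suc n) xs y
    sim-precS {g = g} {n} {xs} {r} {y} rec step = record
      { flag      = flag step ∨ (flag rec ∨ false)
      ; run       = λ B → ev-precS (run rec B)
          (ev-comp (ev-comp (ev-proj (suc (suc zero)) ∷ ev-proj zero
                               ∷ comp₁⇓ (ev-proj (suc zero)) (⇓-cast (half-∷₂ (flag rec) r) (halfᶜ⇓ _))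
                               ∷ drop₃ n _ ⌜ σ ⌝)
                            (run step B)
                     ∷ ev-proj (suc zero) ∷ [])
                   (mergeFlagsᶜ⇓ (flag step) y (flag rec ∷ []) (r ∷ [])))
      ; bounded   = λ eq → bd-precS (bounded rec (∨-conicalˡ _ _ (∨-conicalʳ (flag step) _ eq))) (bounded step (∨-conicalˡ _ _ eq))
      ; unflagged = λ N≤∣σ∣ → cong₂ _∨_ (unflagged step N≤∣σ∣) (cong (_∨ false) (unflagged rec N≤∣σ∣))
      }
      where open Flagged

    sim-prec : ∀ {k} {f : Code k} {g : Code (suc (suc k))} {n xs v} → SimPrec N f g n xs v → Sim N (prec f g) (n ∷ xs) v
    sim-prec {n = n} {xs} r = record
      { flag = flag r
      ; run = λ B → ev-comp (ev-proj (suc zero) ∷ ev-proj zero ∷ drop₂ ⌜ σ ⌝ n) (run r B)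
      ; bounded = bounded r
      ; unflagged = unflagged r
      }
      where open Flagged

    sim-zero : ∀ {k} {xs : Vec ℕ k} → Sim N zeroF xs 0
    sim-zero = record { flag = false ; run = λ _ → ev-zero ; bounded = λ _ → bd-zero ; unflagged = λ _ → refl }

    sim-succ : ∀ {x} → Sim N succF (x ∷ []) (suc x)
    sim-succ {x} = record
      { flag      = false
      ; run       = λ _ → ⇓-cast (sym (+-suc (suc x) x))
                                 (comp₁⇓ (comp₁⇓ (comp₁⇓ (ev-proj (suc zero)) (doubleᶜ⇓ x)) ev-succ) ev-succ)
      ; bounded   = λ _ → bd-succ
      ; unflagged = λ _ → refl
      }

    sim-proj : ∀ {k} (i : Fin k) {xs : Vec ℕ k} → Sim N (proj i) xs (lookup xs i)
    sim-proj i = record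
      { flag = false ; run = λ _ → comp₁⇓ (ev-proj (suc i)) (doubleᶜ⇓ _) ; bounded = λ _ → bd-proj i ; unflagged = λ _ → refl }

    -- The search runs on the values; its flag collects the flags of all the evaluations it inspects.
    sim-mu : ∀ {k} {f : Code (suc k)} {xs n} → Sim N f (n ∷ xs) 0 →
      (∀ i → i < n → ∃ λ v → Sim N f (i ∷ xs) (suc v)) → Sim N (mu f) xs n
    sim-mu {k} {f} {xs} {n} at-n below-n = record
      { flag      = any≤ flagAt n
      ; run       = λ B → ev-comp (search B
                                   ∷ ev-comp (search B ∷ projs⇓ id (⌜ σ ⌝ ∷ xs) (⌜ σ ⌝ ∷ xs) (λ _ → refl))
                                             (flagsUpTo⇓ f ⌜ σ ⌝ xs flagAt n (runAt B) n ≤-refl)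
                                   ∷ [])
                                  (tagᶜ⇓ n (any≤ flagAt n))
      ; bounded   = λ eq → bd-mu (bounded at-n (trans (sym flagAt-n) (any≤-false flagAt n eq n ≤-refl)))
                                 (λ i i<n → proj₁ (below-n i i<n) ,
                                   bounded (proj₂ (below-n i i<n))
                                           (trans (sym (flagAt-< i i<n)) (any≤-false flagAt n eq i (<⇒≤ i<n))))
      ; unflagged = λ N≤∣σ∣ → all-false⇒any≤-false flagAt n (λ j j≤n → unflaggedAt j j≤n N≤∣σ∣)
      }
      where
      open Flagged
      flagAt : ℕ → Bool
      flagAt j with j <? n
      ... | yes j<n = flag (proj₂ (below-n j j<n))
      ... | no _ = flag at-n
      flagAt-< : ∀ j (j<n : j < n) → flagAt j ≡ flag (proj₂ (below-n j j<n))
      flagAt-< j j<n with j <? n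
      ... | yes j<n′ rewrite <-irrelevant j<n j<n′ = refl
      ... | no j≮n = ⊥-elim (j≮n j<n)
      flagAt-n : flagAt n ≡ flag at-n
      flagAt-n with n <? n
      ... | yes n<n = ⊥-elim (<-irrefl refl n<n)
      ... | no _ = refl
      runAt : ∀ B j → j ≤ n → ∃ λ v → B ⊢ sim f [ ⌜ σ ⌝ ∷ j ∷ xs ]⇓ flagAt j ∷₂ v
      runAt B j j≤n with m≤n⇒m<n∨m≡n j≤n
      ... | inj₁ j<n rewrite flagAt-< j j<n = suc (proj₁ (below-n j j<n)) , run (proj₂ (below-n j j<n)) B
      ... | inj₂ refl rewrite flagAt-n = 0 , run at-n B
      unflaggedAt : ∀ j → j ≤ n → N ≤ length σ → flagAt j ≡ false
      unflaggedAt j j≤n N≤∣σ∣ with m≤n⇒m<n∨m≡n j≤n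
      ... | inj₁ j<n = trans (flagAt-< j j<n) (unflagged (proj₂ (below-n j j<n)) N≤∣σ∣)
      ... | inj₂ refl = trans flagAt-n (unflagged at-n N≤∣σ∣)
      search : ∀ B → B ⊢ simSearch f [ ⌜ σ ⌝ ∷ xs ]⇓ n
      search B = ev-mu (value (run at-n B)) (λ i i<n → proj₁ (below-n i i<n) , value (run (proj₂ (below-n i i<n)) B))
        where
        value : ∀ {j b v} → B ⊢ sim f [ ⌜ σ ⌝ ∷ j ∷ xs ]⇓ b ∷₂ v →
          B ⊢ comp halfᶜ (comp (sim f) (#1 ∷ #0 ∷ projs (2 ↑ʳ_)) ∷ []) [ j ∷ ⌜ σ ⌝ ∷ xs ]⇓ v
        value {j} {b} {v} d = comp₁⇓ (ev-comp (ev-proj (suc zero) ∷ ev-proj zero ∷ drop₂ j ⌜ σ ⌝) d)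
                                     (⇓-cast (half-∷₂ b v) (halfᶜ⇓ _))

    sim-oracle : ∀ {x} → x < N → Sim N oracle (x ∷ []) (bit (pad σ x))
    sim-oracle {x} x<N with x <ᵇ length σ | <ᵇ-reflects-< x (length σ) | query
      where
      inRange : ∀ {B} → B ⊢ comp inRangeᶜ (#1 ∷ #0 ∷ []) [ ⌜ σ ⌝ ∷ x ∷ [] ]⇓ bit (x <ᵇ length σ)
      inRange = comp₂⇓ (ev-proj (suc zero)) (ev-proj zero) (inRangeᶜ⇓ x σ)
      query : ∀ B → let r = bit (x <ᵇ length σ) ∧ℕ parity (half^ x ⌜ σ ⌝) in
        B ⊢ sim oracle [ ⌜ σ ⌝ ∷ x ∷ [] ]⇓ (isZero (bit (x <ᵇ length σ)) + (r + r))
      query B = comp₂⇓ (comp₁⇓ inRange (isZeroᶜ⇓ _))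
                       (comp₁⇓ (comp₂⇓ inRange
                                       (comp₂⇓ (ev-proj (suc zero)) (ev-proj zero) (testBitᶜ⇓ x ⌜ σ ⌝))
                                       (∧ℕᶜ⇓ _ _))
                               (doubleᶜ⇓ _))
                       (addᶜ⇓ _ _)
    ... | true | ofʸ x<∣σ∣ | query = record
      { flag      = false
      ; run       = λ B → ⇓-cast (cong (λ b → b + b) (testBit-⌜⌝ x σ x<∣σ∣)) (query B)
      ; bounded   = λ _ → bd-oracle x<∣σ∣
      ; unflagged = λ _ → refl
      }
    ... | false | ofⁿ x≮∣σ∣ | query = record
      { flag      = true
      ; run       = λ B → ⇓-cast (cong (λ b → 1 + (bit b + bit b)) (sym (pad-≥ x σ (≮⇒≥ x≮∣σ∣)))) (query B)
      ; bounded   = λ ()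
      ; unflagged = λ N≤∣σ∣ → ⊥-elim (x≮∣σ∣ (<-≤-trans x<N N≤∣σ∣))
      }

  simulate : ∀ {N k} {c : Code k} {xs v} → pad σ ⊢⟨ N ⟩ c [ xs ]⇓ v → Sim N c xs v
  simulatePrec : ∀ {N k} {f : Code k} {g n xs v} → pad σ ⊢⟨ N ⟩ prec f g [ n ∷ xs ]⇓ v → SimPrec N f g n xs v
  simulate* : ∀ {N k m} {gs : Vec (Code k) m} {xs ys} → pad σ ⊢⟨ N ⟩ gs [ xs ]⇓* ys → Sim* N gs xs ys
  simulate bd-zero = sim-zero
  simulate bd-succ = sim-succ
  simulate (bd-proj i) = sim-proj i
  simulate (bd-comp ds d) = sim-comp (simulate* ds) (simulate d)
  simulate d@(bd-prec0 _) = sim-prec (simulatePrec d)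
  simulate d@(bd-precS _ _) = sim-prec (simulatePrec d)
  simulate (bd-mu d p) = sim-mu (simulate d) (λ i i<n → proj₁ (p i i<n) , simulate (proj₂ (p i i<n)))
  simulate (bd-oracle x<N) = sim-oracle x<N
  simulatePrec (bd-prec0 d) = sim-prec0 (simulate d)
  simulatePrec (bd-precS d e) = sim-precS (simulatePrec d) (simulate e)
  simulate* [] = sim-[]
  simulate* (d ∷ ds) = sim-∷ (simulate d) (simulate* ds)

-- Compactness

update : Cantor → ℕ → Bool → Cantor
update Z k b x with x ≟ k
... | yes _ = b
... | no _ = Z x

update-≡ : ∀ Z k b → update Z k b k ≡ b
update-≡ Z k b with k ≟ k
... | yes _ = refl
... | no k≢k = ⊥-elim (k≢k refl)

update-≢ : ∀ Z k b x → x ≢ k → update Z k b x ≡ Z x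
update-≢ Z k b x x≢k with x ≟ k
... | yes x≡k = ⊥-elim (x≢k x≡k)
... | no _ = refl

agree-update : ∀ {k Z X} → AgreeUpTo k Z X → AgreeUpTo (suc k) (update Z k (X k)) X
agree-update {k} {Z} {X} Z≈X i i<1+k with m<1+n⇒m<n∨m≡n i<1+k
... | inj₁ i<k = trans (update-≢ Z k (X k) i (<⇒≢ i<k)) (Z≈X i i<k)
... | inj₂ refl = update-≡ Z k (X k)

-- If g had no uniform modulus, excluded middle would let us descend along a branch of cylinders on
-- none of which g has a uniform modulus; continuity of g at the limit of that branch is contradicted.
module Compactness (lem : ExcludedMiddle 0ℓ) {V : Set} (g : Cantor → V)
                   (continuous-g : ∀ A → ∃ λ m → ∀ B → AgreeUpTo m A B → g A ≡ g B) where

  UniformOn : ℕ → Cantor → Set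
  UniformOn k Z = ∃ λ m → ∀ X Y → AgreeUpTo k Z X → AgreeUpTo k Z Y → AgreeUpTo m X Y → g X ≡ g Y

  uniformOn-split : ∀ {k Z} → UniformOn (suc k) (update Z k false) → UniformOn (suc k) (update Z k true) → UniformOn k Z
  uniformOn-split {k} {Z} (m₀ , on₀) (m₁ , on₁) = suc k ⊔ (m₀ ⊔ m₁) , on
    where
    on : ∀ X Y → AgreeUpTo k Z X → AgreeUpTo k Z Y → AgreeUpTo (suc k ⊔ (m₀ ⊔ m₁)) X Y → g X ≡ g Y
    on X Y Z≈X Z≈Y X≈Y with X k in Xk
    ... | false = on₀ X Y (subst (λ b → AgreeUpTo (suc k) (update Z k b) X) Xk (agree-update Z≈X))
                          (subst (λ b → AgreeUpTo (suc k) (update Z k b) Y) (trans Yk≡Xk Xk) (agree-update Z≈Y))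
                          (λ i i<m₀ → X≈Y i (<-≤-trans i<m₀ (≤-trans (m≤m⊔n m₀ m₁) (m≤n⊔m (suc k) (m₀ ⊔ m₁)))))
      where Yk≡Xk = sym (X≈Y k (<-≤-trans ≤-refl (m≤m⊔n (suc k) (m₀ ⊔ m₁))))
    ... | true = on₁ X Y (subst (λ b → AgreeUpTo (suc k) (update Z k b) X) Xk (agree-update Z≈X))
                         (subst (λ b → AgreeUpTo (suc k) (update Z k b) Y) (trans Yk≡Xk Xk) (agree-update Z≈Y))
                         (λ i i<m₁ → X≈Y i (<-≤-trans i<m₁ (≤-trans (m≤n⊔m m₀ m₁) (m≤n⊔m (suc k) (m₀ ⊔ m₁)))))
      where Yk≡Xk = sym (X≈Y k (<-≤-trans ≤-refl (m≤m⊔n (suc k) (m₀ ⊔ m₁))))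

  decide : ∀ {Q : Set} → Dec Q → Bool
  decide (yes _) = true
  decide (no _) = false

  -- branch k fixes the first k bits: it turns right exactly when the left cylinder is uniform
  branch : ℕ → Cantor
  branch zero = λ _ → false
  branch (suc k) = update (branch k) k (decide (lem {UniformOn (suc k) (update (branch k) k false)}))

  branch-not-uniform : ¬ UniformOn 0 (branch 0) → ∀ k → ¬ UniformOn k (branch k)
  branch-not-uniform ¬u₀ zero = ¬u₀
  branch-not-uniform ¬u₀ (suc k) = step (lem {UniformOn (suc k) (update (branch k) k false)})
    where
    step : (d : Dec (UniformOn (suc k) (update (branch k) k false))) →
      ¬ UniformOn (suc k) (update (branch k) k (decide d))
    step (yes u-left) u-right = branch-not-uniform ¬u₀ k (uniformOn-split u-left u-right)
    step (no ¬u-left) = ¬u-left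

  branch-stable : ∀ i d → branch (suc i + d) i ≡ branch (suc i) i
  branch-stable i zero rewrite +-identityʳ i = refl
  branch-stable i (suc d) rewrite +-suc i d =
    trans (update-≢ (branch (suc i + d)) (suc i + d) _ i (λ i≡ → <-irrefl i≡ (s≤s (m≤m+n i d)))) (branch-stable i d)

  limit : Cantor
  limit x = branch (suc x) x

  branch≈limit : ∀ k → AgreeUpTo k (branch k) limit
  branch≈limit k i i<k = subst (λ j → branch j i ≡ limit i) (m+[n∸m]≡n i<k) (branch-stable i (k ∸ suc i))

  uniformly-continuous : ∃ λ m → ∀ X Y → AgreeUpTo m X Y → g X ≡ g Y
  uniformly-continuous with lem {UniformOn 0 (branch 0)}
  ... | yes (m , on) = m , λ X Y → on X Y (λ _ ()) (λ _ ())
  ... | no ¬u₀ with continuous-g limit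
  ... | m , at-limit = ⊥-elim (branch-not-uniform ¬u₀ m (0 , λ X Y X≈ Y≈ _ →
          trans (sym (at-limit X (λ i i<m → trans (sym (branch≈limit m i i<m)) (X≈ i i<m))))
                (at-limit Y (λ i i<m → trans (sym (branch≈limit m i i<m)) (Y≈ i i<m)))))

-- Decision trees

ifᶜ : Code 1 → Code 1 → Code 1 → Code 1
ifᶜ t c₁ c₀ = comp (prec c₀ (comp c₁ (#2 ∷ []))) (t ∷ #0 ∷ [])

ifᶜ-false : ∀ {B t c₁ c₀ s v} → B ⊢ t [ s ∷ [] ]⇓ 0 → B ⊢ c₀ [ s ∷ [] ]⇓ v → B ⊢ ifᶜ t c₁ c₀ [ s ∷ [] ]⇓ v
ifᶜ-false t⇓ c₀⇓ = ev-comp (t⇓ ∷ ev-proj zero ∷ []) (ev-prec0 c₀⇓)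

-- prec evaluates the else branch even when the test is 1
ifᶜ-true : ∀ {B t c₁ c₀ s v₀ v} → B ⊢ t [ s ∷ [] ]⇓ 1 → B ⊢ c₀ [ s ∷ [] ]⇓ v₀ → B ⊢ c₁ [ s ∷ [] ]⇓ v →
  B ⊢ ifᶜ t c₁ c₀ [ s ∷ [] ]⇓ v
ifᶜ-true t⇓ c₀⇓ c₁⇓ =
  ev-comp (t⇓ ∷ ev-proj zero ∷ []) (ev-precS (ev-prec0 c₀⇓) (comp₁⇓ (ev-proj (suc (suc zero))) c₁⇓))

testBitAtᶜ : ℕ → Code 1
testBitAtᶜ k = comp testBitᶜ (constᶜ k ∷ #0 ∷ [])

testBitAtᶜ⇓ : ∀ {B} k σ → k < length σ → B ⊢ testBitAtᶜ k [ ⌜ σ ⌝ ∷ [] ]⇓ bit (pad σ k)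
testBitAtᶜ⇓ k σ k<∣σ∣ = ⇓-cast (testBit-⌜⌝ k σ k<∣σ∣) (comp₂⇓ (constᶜ⇓ k) (ev-proj zero) (testBitᶜ⇓ k ⌜ σ ⌝))

module _ (g : Cantor → Bool) where

  tree : Cantor → ℕ → ℕ → Code 1
  tree Z k zero = constᶜ (bit (g Z))
  tree Z k (suc d) = ifᶜ (testBitAtᶜ k) (tree (update Z k true) (suc k) d) (tree (update Z k false) (suc k) d)

  tree-total : ∀ {B} d Z k s → ∃ λ v → B ⊢ tree Z k d [ s ∷ [] ]⇓ v
  tree-total zero Z k s = _ , constᶜ⇓ _
  tree-total (suc d) Z k s = _ , ev-comp (comp₂⇓ (constᶜ⇓ k) (ev-proj zero) (testBitᶜ⇓ k s) ∷ ev-proj zero ∷ [])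
                                         (proj₂ (branches (parity (half^ k s))))
    where
    branches : ∀ b → ∃ λ v →
      _ ⊢ prec (tree (update Z k false) (suc k) d) (comp (tree (update Z k true) (suc k) d) (#2 ∷ [])) [ b ∷ s ∷ [] ]⇓ v
    branches zero = _ , ev-prec0 (proj₂ (tree-total d _ (suc k) s))
    branches (suc b) = _ , ev-precS (proj₂ (branches b)) (comp₁⇓ (ev-proj (suc (suc zero))) (proj₂ (tree-total d _ (suc k) s)))

  tree⇓ : ∀ {B} d Z k σ → AgreeUpTo k Z (pad σ) → k + d ≤ length σ →
    ∃ λ W → AgreeUpTo (k + d) W (pad σ) × B ⊢ tree Z k d [ ⌜ σ ⌝ ∷ [] ]⇓ bit (g W)
  tree⇓ zero Z k σ Z≈σ _ = Z , subst (λ j → AgreeUpTo j Z (pad σ)) (sym (+-identityʳ k)) Z≈σ , constᶜ⇓ _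
  tree⇓ {B} (suc d) Z k σ Z≈σ k+1+d≤∣σ∣
    with pad σ k | agree-update {k} {Z} {pad σ} Z≈σ | testBitAtᶜ⇓ {B} k σ (<-≤-trans (m<m+n k (s≤s z≤n)) k+1+d≤∣σ∣)
  ... | b | Z′≈σ | test with tree⇓ {B} d (update Z k b) (suc k) σ Z′≈σ (subst (_≤ length σ) (+-suc k d) k+1+d≤∣σ∣)
  ... | W , W≈σ , run = W , subst (λ j → AgreeUpTo j W (pad σ)) (sym (+-suc k d)) W≈σ , branch b test run
    where
    branch : ∀ b → B ⊢ testBitAtᶜ k [ ⌜ σ ⌝ ∷ [] ]⇓ bit b →
      B ⊢ tree (update Z k b) (suc k) d [ ⌜ σ ⌝ ∷ [] ]⇓ bit (g W) →
      B ⊢ tree Z k (suc d) [ ⌜ σ ⌝ ∷ [] ]⇓ bit (g W)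
    branch false test run = ifᶜ-false test run
    branch true test run = ifᶜ-true test (proj₂ (tree-total d _ (suc k) ⌜ σ ⌝)) run

  treeᶜ : ℕ → Code 1
  treeᶜ m = tree (λ _ → false) 0 m

  treeᶜ⇓ : ∀ {B} m → (∀ X Y → AgreeUpTo m X Y → g X ≡ g Y) → ∀ σ → m ≤ length σ →
    B ⊢ treeᶜ m [ ⌜ σ ⌝ ∷ [] ]⇓ bit (g (pad σ))
  treeᶜ⇓ {B} m modulus σ m≤∣σ∣ with tree⇓ {B} m (λ _ → false) 0 σ (λ _ ()) m≤∣σ∣
  ... | W , W≈σ , run = ⇓-cast (cong bit (modulus W (pad σ) W≈σ)) run

least-false : (P : ℕ → Bool) → ∀ w → P w ≡ false → ∃ λ n → P n ≡ false × (∀ i → i < n → P i ≡ true)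
least-false P zero P0 = 0 , P0 , λ _ ()
least-false P (suc w) P[1+w] with P 0 in P0
... | false = 0 , P0 , λ _ ()
... | true with least-false (P ∘ suc) w P[1+w]
...   | n , Pn , below = suc n , Pn , λ { zero _ → P0 ; (suc i) (s≤s i<n) → below i i<n }

mu⇓ : ∀ {A k} {f : Code (suc k)} {xs} (P : ℕ → Bool) {n} → (∀ i → A ⊢ f [ i ∷ xs ]⇓ bit (P i)) →
  P n ≡ false → (∀ i → i < n → P i ≡ true) → A ⊢ mu f [ xs ]⇓ n
mu⇓ P f⇓ Pn below = ev-mu (⇓-cast (cong bit Pn) (f⇓ _)) (λ i i<n → 0 , ⇓-cast (cong bit (below i i<n)) (f⇓ i))

<ᵇ-true : ∀ {m n} → m < n → (m <ᵇ n) ≡ true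
<ᵇ-true m<n = Equivalence.to T-≡ (<⇒<ᵇ m<n)

<ᵇ-irrefl : ∀ n → (n <ᵇ n) ≡ false
<ᵇ-irrefl zero = refl
<ᵇ-irrefl (suc n) = <ᵇ-irrefl n

∷₂-injectiveˡ : ∀ a b m n → a ∷₂ m ≡ b ∷₂ n → a ≡ b
∷₂-injectiveˡ a b m n eq = bit-injective (trans (sym (parity-∷₂ a m)) (trans (cong parity eq) (parity-∷₂ b n)))

maxUpTo : (ℕ → ℕ) → ℕ → ℕ
maxUpTo f zero = 0
maxUpTo f (suc R) = maxUpTo f R ⊔ f R

≤-maxUpTo : ∀ f R x → x < R → f x ≤ maxUpTo f R
≤-maxUpTo f (suc R) x x<1+R with m<1+n⇒m<n∨m≡n x<1+R
... | inj₁ x<R = ≤-trans (≤-maxUpTo f R x x<R) (m≤m⊔n _ _)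
... | inj₂ refl = m≤n⊔m _ _

-- Approximating the orbit of A under F = Θ⁻¹ ∘ S⋆ ∘ Θ by finite strings

module Orbit (Θ : Cantor → Cantor) (h : IsHomeomorphism Θ) (Φ : Code 1)
             (Φ⇓ : ∀ A x → A ⊢ Φ [ x ∷ [] ]⇓ bit ((inverse h ∘C (S⋆ ∘C Θ)) A x)) where

  F : Cantor → Cantor
  F = inverse h ∘C (S⋆ ∘C Θ)

  F^ : ℕ → Cantor → Cantor
  F^ zero A = A
  F^ (suc n) A = F (F^ n A)

  Θ∘F^ : ∀ n A j → Θ (F^ n A) j ≡ Θ A (n + j)
  Θ∘F^ zero A j = refl
  Θ∘F^ (suc n) A j = begin
    Θ (F (F^ n A)) j      ≡⟨ right-inv h (S⋆ (Θ (F^ n A))) j ⟩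
    Θ (F^ n A) (suc j)    ≡⟨ Θ∘F^ n A (suc j) ⟩
    Θ A (n + suc j)       ≡⟨ cong (Θ A) (+-suc n j) ⟩
    Θ A (suc n + j)       ∎
    where open ≡-Reasoning

  simΦ : ∀ σ x → ∃ λ N → Simulation.Sim σ N Φ (x ∷ []) (bit (F (pad σ) x))
  simΦ σ x = _ , Simulation.simulate σ (proj₂ (⇓⇒bounded (Φ⇓ (pad σ) x)))

  overflow : List Bool → ℕ → Bool
  overflow σ x = Simulation.Flagged.flag (proj₂ (simΦ σ x))

  simΦ⇓ : ∀ {B} σ x → B ⊢ sim Φ [ ⌜ σ ⌝ ∷ x ∷ [] ]⇓ overflow σ x ∷₂ bit (F (pad σ) x)
  simΦ⇓ {B} σ x = Simulation.Flagged.run (proj₂ (simΦ σ x)) B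

  no-overflow⇒bounded : ∀ σ x → overflow σ x ≡ false → pad σ ⊢⟨ length σ ⟩ Φ [ x ∷ [] ]⇓ bit (F (pad σ) x)
  no-overflow⇒bounded σ x = Simulation.Flagged.bounded (proj₂ (simΦ σ x))

  bounded⇒no-overflow : ∀ σ x {v} → pad σ ⊢⟨ length σ ⟩ Φ [ x ∷ [] ]⇓ v → overflow σ x ≡ false
  bounded⇒no-overflow σ x {v} d =
    trans (∷₂-injectiveˡ (overflow σ x) (flag r) (bit (F (pad σ) x)) v (⇓-deterministic (simΦ⇓ σ x) (run r (pad σ))))
          (unflagged r ≤-refl)
    where
    open Simulation.Flagged
    r = Simulation.simulate σ d

  valueᶜ : Code 2
  valueᶜ = comp halfᶜ (comp (sim Φ) (#1 ∷ #0 ∷ []) ∷ [])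

  valueᶜ⇓ : ∀ {B} σ x → B ⊢ valueᶜ [ x ∷ ⌜ σ ⌝ ∷ [] ]⇓ bit (F (pad σ) x)
  valueᶜ⇓ σ x = comp₁⇓ (comp₂⇓ (ev-proj (suc zero)) (ev-proj zero) (simΦ⇓ σ x))
                       (⇓-cast (half-∷₂ (overflow σ x) (bit (F (pad σ) x))) (halfᶜ⇓ _))

  ok : List Bool → ℕ → Bool
  ok σ x = (x <ᵇ length σ) ∧ not (overflow σ x)

  okᶜ : Code 2
  okᶜ = comp ∧ℕᶜ (inRangeᶜ ∷ comp isZeroᶜ (comp parityᶜ (comp (sim Φ) (#1 ∷ #0 ∷ []) ∷ []) ∷ []) ∷ [])

  okᶜ⇓ : ∀ {B} σ x → B ⊢ okᶜ [ x ∷ ⌜ σ ⌝ ∷ [] ]⇓ bit (ok σ x)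
  okᶜ⇓ σ x = ⇓-cast (∧ℕ-bit (x <ᵇ length σ) (not (overflow σ x)))
    (comp₂⇓ (inRangeᶜ⇓ x σ)
            (comp₁⇓ (comp₁⇓ (comp₂⇓ (ev-proj (suc zero)) (ev-proj zero) (simΦ⇓ σ x))
                            (⇓-cast (parity-∷₂ (overflow σ x) (bit (F (pad σ) x))) (parityᶜ⇓ _)))
                    (⇓-cast (isZero-bit (overflow σ x)) (isZeroᶜ⇓ _)))
            (∧ℕᶜ⇓ _ _))

  ok⇒no-overflow : ∀ σ x → ok σ x ≡ true → overflow σ x ≡ false
  ok⇒no-overflow σ x eq = not-injective (∧-conicalʳ (x <ᵇ length σ) _ eq)

  ok-length : ∀ σ → ok σ (length σ) ≡ false
  ok-length σ = cong (_∧ not (overflow σ (length σ))) (<ᵇ-irrefl (length σ))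

  goodLength : List Bool → ℕ
  goodLength σ = proj₁ (least-false (ok σ) (length σ) (ok-length σ))

  goodLength-not-ok : ∀ σ → ok σ (goodLength σ) ≡ false
  goodLength-not-ok σ = proj₁ (proj₂ (least-false (ok σ) (length σ) (ok-length σ)))

  goodLength-ok : ∀ σ x → x < goodLength σ → ok σ x ≡ true
  goodLength-ok σ = proj₂ (proj₂ (least-false (ok σ) (length σ) (ok-length σ)))

  goodLength-maximal : ∀ σ R → (∀ x → x < R → ok σ x ≡ true) → R ≤ goodLength σ
  goodLength-maximal σ R below-R = ≮⇒≥ λ gl<R → case trans (sym (goodLength-not-ok σ)) (below-R (goodLength σ) gl<R) of λ ()

  goodLengthᶜ⇓ : ∀ {B} σ → B ⊢ mu okᶜ [ ⌜ σ ⌝ ∷ [] ]⇓ goodLength σ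
  goodLengthᶜ⇓ σ = mu⇓ (ok σ) (okᶜ⇓ σ) (goodLength-not-ok σ) (goodLength-ok σ)

  step : List Bool → List Bool
  step σ = prefix (F (pad σ)) (goodLength σ)

  stepᶜ : Code 1
  stepᶜ = comp (prefixᶜ valueᶜ) (mu okᶜ ∷ #0 ∷ [])

  stepᶜ⇓ : ∀ {B} σ → B ⊢ stepᶜ [ ⌜ σ ⌝ ∷ [] ]⇓ ⌜ step σ ⌝
  stepᶜ⇓ σ = comp₂⇓ (goodLengthᶜ⇓ σ) (ev-proj zero) (prefixᶜ⇓ valueᶜ (F (pad σ)) ⌜ σ ⌝ (valueᶜ⇓ σ) (goodLength σ))

  step-⊑ : ∀ σ A → σ ⊑ A → step σ ⊑ F A
  step-⊑ σ A σ⊑A x x<∣step∣ =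
    trans (pad-prefix (F (pad σ)) (goodLength σ) x x<gl) (bit-injective (⇓-deterministic Φ-on-A (Φ⇓ A x)))
    where
    x<gl : x < goodLength σ
    x<gl = subst (x <_) (length-prefix _ _) x<∣step∣
    Φ-on-A : A ⊢ Φ [ x ∷ [] ]⇓ bit (F (pad σ) x)
    Φ-on-A = bounded⇒⇓ (bounded-transfer σ⊑A (no-overflow⇒bounded σ x (ok⇒no-overflow σ x (goodLength-ok σ x x<gl))))

  steps : ℕ → List Bool → List Bool
  steps zero σ = σ
  steps (suc n) σ = step (steps n σ)

  steps-suc : ∀ n σ → steps (suc n) σ ≡ steps n (step σ)
  steps-suc zero σ = refl
  steps-suc (suc n) σ = cong step (steps-suc n σ)

  steps-⊑ : ∀ n σ A → σ ⊑ A → steps n σ ⊑ F^ n A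
  steps-⊑ zero σ A σ⊑A = σ⊑A
  steps-⊑ (suc n) σ A σ⊑A = step-⊑ (steps n σ) (F^ n A) (steps-⊑ n σ A σ⊑A)

  stepsᶜ : Code 2
  stepsᶜ = prec (comp (prefixᶜ (comp oracle (#0 ∷ []))) (#0 ∷ #0 ∷ [])) (comp stepᶜ (#1 ∷ []))

  stepsᶜ⇓ : ∀ A n N → A ⊢ stepsᶜ [ n ∷ N ∷ [] ]⇓ ⌜ steps n (prefix A N) ⌝
  stepsᶜ⇓ A zero N =
    ev-prec0 (comp₂⇓ (ev-proj zero) (ev-proj zero) (prefixᶜ⇓ _ A N (λ x → comp₁⇓ (ev-proj zero) ev-oracle) N))
  stepsᶜ⇓ A (suc n) N = ev-precS (stepsᶜ⇓ A n N) (comp₁⇓ (ev-proj (suc zero)) (stepᶜ⇓ (steps n (prefix A N))))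

  module _ (A : Cantor) where

    use : ℕ → ℕ → ℕ
    use k x = proj₁ (⇓⇒bounded (Φ⇓ (F^ k A) x))

    step-long : ∀ k σ R → σ ⊑ F^ k A → R ≤ length σ → maxUpTo (use k) R ≤ length σ → R ≤ length (step σ)
    step-long k σ R σ⊑ R≤∣σ∣ use≤∣σ∣ = subst (R ≤_) (sym (length-prefix _ _)) (goodLength-maximal σ R ok-below-R)
      where
      ok-below-R : ∀ x → x < R → ok σ x ≡ true
      ok-below-R x x<R = cong₂ _∧_ (<ᵇ-true (<-≤-trans x<R R≤∣σ∣)) (cong not (bounded⇒no-overflow σ x on-pad))
        where
        on-pad : pad σ ⊢⟨ length σ ⟩ Φ [ x ∷ [] ]⇓ bit (F (F^ k A) x)
        on-pad = bounded-transfer (λ i i<∣σ∣ → sym (σ⊑ i i<∣σ∣))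
                   (bounded-mono (≤-trans (≤-maxUpTo (use k) R x x<R) use≤∣σ∣) (proj₂ (⇓⇒bounded (Φ⇓ (F^ k A) x))))

    -- the length needed at stage k for j further steps to reach length R
    required : ℕ → ℕ → ℕ → ℕ
    required R zero k = R
    required R (suc j) k = required R j (suc k) ⊔ maxUpTo (use k) (required R j (suc k))

    steps-long : ∀ R j k σ → σ ⊑ F^ k A → required R j k ≤ length σ → R ≤ length (steps j σ)
    steps-long R zero k σ σ⊑ R≤∣σ∣ = R≤∣σ∣
    steps-long R (suc j) k σ σ⊑ req≤∣σ∣ rewrite steps-suc j σ =
      steps-long R j (suc k) (step σ) (step-⊑ σ (F^ k A) σ⊑)
        (step-long k σ _ σ⊑ (≤-trans (m≤m⊔n _ _) req≤∣σ∣) (≤-trans (m≤n⊔m _ _) req≤∣σ∣))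

  module _ (m : ℕ) where

    short : Cantor → ℕ → ℕ → Bool
    short A n N = not (m <ᵇ length (steps n (prefix A N)))

    shortᶜ : Code 2
    shortᶜ = comp isZeroᶜ (comp inRangeᶜ (constᶜ m ∷ comp stepsᶜ (#1 ∷ #0 ∷ []) ∷ []) ∷ [])

    shortᶜ⇓ : ∀ A n N → A ⊢ shortᶜ [ N ∷ n ∷ [] ]⇓ bit (short A n N)
    shortᶜ⇓ A n N = comp₁⇓ (comp₂⇓ (constᶜ⇓ m) (comp₂⇓ (ev-proj (suc zero)) (ev-proj zero) (stepsᶜ⇓ A n N))
                                   (inRangeᶜ⇓ m (steps n (prefix A N))))
                           (⇓-cast (isZero-bit _) (isZeroᶜ⇓ _))

    -- search for an initial segment of A long enough for n steps to leave m bits, then read off Θ A n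
    Ψ : Code 1
    Ψ = comp (treeᶜ (λ X → Θ X 0) m) (comp stepsᶜ (#0 ∷ mu shortᶜ ∷ []) ∷ [])

    Ψ⇓ : (∀ X Y → AgreeUpTo m X Y → Θ X 0 ≡ Θ Y 0) → ∀ A n → A ⊢ Ψ [ n ∷ [] ]⇓ bit (Θ A n)
    Ψ⇓ modulus A n with least-false (short A n) R long-R
      where
      R = required A (suc m) n 0
      long-R : short A n R ≡ false
      long-R = cong not (<ᵇ-true (steps-long A (suc m) n 0 (prefix A R) (prefix-⊑ A R)
                                              (≤-reflexive (sym (length-prefix A R)))))
    ... | N , long , below = ⇓-cast (cong bit Θ-at-n)
          (comp₁⇓ (comp₂⇓ (ev-proj zero) (mu⇓ (short A n) (shortᶜ⇓ A n) long below) (stepsᶜ⇓ A n N))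
                  (treeᶜ⇓ (λ X → Θ X 0) m modulus σ m≤∣σ∣))
      where
      σ = steps n (prefix A N)
      m≤∣σ∣ : m ≤ length σ
      m≤∣σ∣ = <⇒≤ (<ᵇ⇒< m (length σ) (Equivalence.from T-≡ (not-injective long)))
      σ⊑Fⁿ : σ ⊑ F^ n A
      σ⊑Fⁿ = steps-⊑ n (prefix A N) A (prefix-⊑ A N)
      Θ-at-n : Θ (pad σ) 0 ≡ Θ A n
      Θ-at-n = begin
        Θ (pad σ) 0     ≡⟨ modulus (pad σ) (F^ n A) (λ i i<m → σ⊑Fⁿ i (<-≤-trans i<m m≤∣σ∣)) ⟩
        Θ (F^ n A) 0    ≡⟨ Θ∘F^ n A 0 ⟩
        Θ A (n + 0)     ≡⟨ cong (Θ A) (+-identityʳ n) ⟩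
        Θ A n           ∎
        where open ≡-Reasoning

lemma3p4 : ExcludedMiddle 0ℓ → (Θ : Cantor → Cantor) → (h : IsHomeomorphism Θ) →
    Computable (inverse h ∘C (S⋆ ∘C Θ)) → Computable Θ
lemma3p4 lem Θ h (Φ , Φ⇓) with Compactness.uniformly-continuous lem (λ X → Θ X 0) (λ A → continuous h A 0)
... | m , modulus = Ψ m , Ψ⇓ m modulus
  where open Orbit Θ h Φ Φ⇓
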